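{- For every $q\in\{0,1,6,7,8,9,E,F\}$ and every binary relation $R$ on a set $X$: $R^q$ is left Euclidean if and only if $R^q$ is transitive.
   Context: A binary relation $R$ on $X$ is a subset of $X\times X$; write $xRy$. Unary operations are indexed by hexadecimal digits $p\in\{0,\dots,F\}$, read as 4-bit numbers $p=8p_8+4p_4+2p_2+p_1$; $xR^py$ iff $(\lnot xRy\land\lnot yRx\land p_8=1)\lor(\lnot xRy\land yRx\land p_4=1)\lor(xRy\land\lnot yRx\land p_2=1)\lor(xRy\land yRx\land p_1=1)$. Left Euclidean: $yRx\land zRx\to yRz$ for all $x,y,z$; transitive: $xRy\land yRz\to xRz$. -}

module Defs where

open import Data.Bool using (Bool; true; false; _∧_; _∨_; not; T)
open import Data.Nat using (ℕ; zero; suc; _≡ᵇ_)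
open import Data.Nat.DivMod using (_/_; _%_)

-- A binary relation on X, given as its characteristic function
-- (a subset of X × X, classically every subset has one).
BRel : Set → Set
BRel X = X → X → Bool

-- bit k of a natural number p: p₈ = bit 3, p₄ = bit 2, p₂ = bit 1, p₁ = bit 0
bit : ℕ → ℕ → Bool
bit p zero    = (p % 2) ≡ᵇ 1
bit p (suc k) = bit (p / 2) k

_^[_] : {X : Set} → BRel X → ℕ → BRel X
(R ^[ p ]) x y =
     (not (R x y) ∧ not (R y x) ∧ bit p 3)
  ∨ (not (R x y) ∧ R y x ∧ bit p 2)
  ∨ (R x y ∧ not (R y x) ∧ bit p 1)
  ∨ (R x y ∧ R y x ∧ bit p 0)

LeftEuclidean : {X : Set} → BRel X → Set
LeftEuclidean {X} R = (x y z : X) → T (R y x) → T (R z x) → T (R y z)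

Transitive : {X : Set} → BRel X → Set
Transitive {X} R = (x y z : X) → T (R x y) → T (R y z) → T (R x z)

data InQ : ℕ → Set where
  q0 : InQ 0
  q1 : InQ 1
  q6 : InQ 6
  q7 : InQ 7
  q8 : InQ 8
  q9 : InQ 9
  qE : InQ 14
  qF : InQ 15

-- For every q ∈ Q the bits q₄ and q₂ agree, so R^q treats the two asymmetric
-- cases alike and is symmetric; and for a symmetric relation the hypotheses
-- of left Euclideanity and of transitivity differ only by flipping one edge.
module Submission where

open import Defs
open import Data.Nat using (ℕ)
open import Data.Product using (_×_; _,_)
open import Data.Bool using (true; false; _∨_; T)
open import Function using (id)
open import Relation.Binary.PropositionalEquality using (_≡_; refl; sym; subst)

Symmetric : {X : Set} → BRel X → Set
Symmetric {X} S = (x y : X) → T (S x y) → T (S y x)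

module _ {X : Set} {S : BRel X} (S-sym : Symmetric S) where

  leftEuclidean⇒transitive : LeftEuclidean S → Transitive S
  leftEuclidean⇒transitive le x y z Sxy Syz = le y x z Sxy (S-sym y z Syz)

  transitive⇒leftEuclidean : Transitive S → LeftEuclidean S
  transitive⇒leftEuclidean tr x y z Syx Szx = tr y x z Syx (S-sym z x Szx)

^-symmetric : {X : Set} (R : BRel X) (p : ℕ) → bit p 1 ≡ bit p 2 → Symmetric (R ^[ p ])
^-symmetric R p bits x y with R x y | R y x
... | true  | true  = id
... | false | false = id
-- In the asymmetric cases R ^[ p ] x y normalises to  bit p i ∨ false.
... | true  | false = subst (λ b → T (b ∨ false)) bits
... | false | true  = subst (λ b → T (b ∨ false)) (sym bits)

InQ⇒bit₁≡bit₂ : {q : ℕ} → InQ q → bit q 1 ≡ bit q 2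
InQ⇒bit₁≡bit₂ q0 = refl
InQ⇒bit₁≡bit₂ q1 = refl
InQ⇒bit₁≡bit₂ q6 = refl
InQ⇒bit₁≡bit₂ q7 = refl
InQ⇒bit₁≡bit₂ q8 = refl
InQ⇒bit₁≡bit₂ q9 = refl
InQ⇒bit₁≡bit₂ qE = refl
InQ⇒bit₁≡bit₂ qF = refl

mainTheorem7 : (q : ℕ) → InQ q → (X : Set) → (R : BRel X) →
    (LeftEuclidean (R ^[ q ]) → Transitive (R ^[ q ])) × (Transitive (R ^[ q ]) → LeftEuclidean (R ^[ q ]))
mainTheorem7 q q∈Q _ R = leftEuclidean⇒transitive symmetric , transitive⇒leftEuclidean symmetric
  where
  symmetric : Symmetric (R ^[ q ])
  symmetric = ^-symmetric R q (InQ⇒bit₁≡bit₂ q∈Q)
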